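{- Let $U$ be an ultrafilter on $\omega\times\omega$ such that $\mathrm{fin}\otimes\mathrm{fin}\subseteq U^*$, $U$ has the $\mathrm{fin}\otimes\mathrm{fin}$-pseudo intersection property, and $\prod_{n<\omega}(\omega^\omega,\le)\le_T U$. Then $U\cdot U\equiv_T U$.
   Context: $\mathrm{fin}\otimes\mathrm{fin}$ is the ideal on $\omega\times\omega$ of all $A$ with $\{n:\{m:(n,m)\in A\}\text{ infinite}\}$ finite. $U^*=P(\omega\times\omega)\setminus U$. For an ideal $I\subseteq U^*$, $U$ has the $I$-pseudo intersection property if for every $\langle A_n\rangle_{n<\omega}\subseteq U$ there is $A\in U$ with $A\setminus A_n\in I$ for all $n$. $\omega^\omega$ carries the everywhere domination order and products the coordinatewise order; $U$ is ordered by $\supseteq$. $U\cdot U$ is the filter with $A\in U\cdot U$ iff $\{x:\{y:(x,y)\in A\}\in U\}\in U$. $P\le_TQ$ means there is $f:Q\to P$ mapping cofinal subsets to cofinal subsets; $\equiv_T$ is two-way $\le_T$. -}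

module Defs where

open import Level using (Level; _⊔_) renaming (suc to lsuc; zero to lzero)
open import Data.Nat using (ℕ; _≤_; _<_)
open import Data.Product using (Σ; ∃; _×_; _,_; proj₁)
open import Data.Sum using (_⊎_)
open import Data.Empty using (⊥)
open import Relation.Nullary using (¬_)
open import Data.Unit using (⊤)
open import Relation.Binary.PropositionalEquality using (_≡_)

Subset : Set → Set₁
Subset X = X → Set

_⊆ˢ_ : {X : Set} → Subset X → Subset X → Set
A ⊆ˢ B = ∀ x → A x → B x

FiniteSet : Subset ℕ → Set
FiniteSet P = ∃ λ N → ∀ n → P n → n < N

InfiniteSet : Subset ℕ → Set
InfiniteSet P = ∀ k → ∃ λ m → k ≤ m × P m

Family : Set → Set₁
Family X = Subset X → Set

record IsUltrafilter {X : Set} (U : Family X) : Set₁ where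
  field
    upward  : ∀ A B → A ⊆ˢ B → U A → U B
    inter   : ∀ A B → U A → U B → U (λ x → A x × B x)
    whole   : U (λ _ → ⊤)
    proper  : ¬ U (λ _ → ⊥)
    ultra   : ∀ A → U A ⊎ U (λ x → ¬ A x)

FinFin : Family (ℕ × ℕ)
FinFin A = FiniteSet (λ n → InfiniteSet (λ m → A (n , m)))

IdealInDual : {X : Set} → Family X → Family X → Set₁
IdealInDual I U = ∀ A → I A → ¬ U A

PseudoIntersection : {X : Set} → Family X → Family X → Set₁
PseudoIntersection {X} I U =
  ∀ (S : ℕ → Subset X) → (∀ n → U (S n)) →
  Σ (Subset X) λ A → U A × (∀ n → I (λ x → A x × ¬ S n x))

_·ᶠ_ : {X : Set} → Family X → Family X → Family (X × X)
(U ·ᶠ V) A = U (λ x → V (λ y → A (x , y)))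

Cofinal : ∀ {a r} {Q : Set a} (_≤_ : Q → Q → Set r) → (Q → Set₁) → Set (a ⊔ r ⊔ lsuc lzero)
Cofinal {Q = Q} _≤_ C = ∀ q → Σ Q λ q' → C q' × q ≤ q'

TukeyLe : ∀ {a r b s} (P : Set a) (_≤P_ : P → P → Set r) (Q : Set b) (_≤Q_ : Q → Q → Set s)
        → Set (a ⊔ r ⊔ b ⊔ s ⊔ lsuc (lsuc lzero))
TukeyLe P _≤P_ Q _≤Q_ =
  Σ (Q → P) λ f → ∀ (C : Q → Set₁) → Cofinal _≤Q_ C →
    (∀ p → Σ Q λ q → C q × p ≤P f q)

TukeyEq : ∀ {a r b s} (P : Set a) (_≤P_ : P → P → Set r) (Q : Set b) (_≤Q_ : Q → Q → Set s)
        → Set (a ⊔ r ⊔ b ⊔ s ⊔ lsuc (lsuc lzero))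
TukeyEq P _≤P_ Q _≤Q_ = TukeyLe P _≤P_ Q _≤Q_ × TukeyLe Q _≤Q_ P _≤P_

Elems : {X : Set} → Family X → Set₁
Elems {X} U = Σ (Subset X) U

_⊇ᵁ_ : {X : Set} {U : Family X} → Elems U → Elems U → Set
(A , _) ⊇ᵁ (B , _) = B ⊆ˢ A

Baire : Set
Baire = ℕ → ℕ

_≤ᴮ_ : Baire → Baire → Set
f ≤ᴮ g = ∀ n → f n ≤ g n

ProdBaire : Set
ProdBaire = ℕ → Baire

_≤ᴾ_ : ProdBaire → ProdBaire → Set
F ≤ᴾ G = ∀ n → F n ≤ᴮ G n

{-# OPTIONS --safe #-}
module Submission where

-- Reduction U·U ≤T U: every B ∈ U·U is refined by the image of a small enough A ∈ U under
-- A ↦ {(x , y) : x , y ∈ A and y lies above the graph of the x-th coordinate of h A},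
-- where h : U → ∏ ω^ω is the given Tukey map. Indeed, a fin⊗fin-pseudo-intersection A* of the
-- sections of B lies, above the graph of some Gₓ, inside the section Bₓ; as h is Tukey, h A
-- dominates every Gₓ once A is small. The reduction U ≤T U·U is B ↦ {x : Bₓ ∈ U}.

open import Defs
open import Level using (Level; Lift; lift) renaming (suc to lsuc; zero to lzero)
open import Data.Nat using (ℕ; zero; suc; _+_; _≤_; _<_; _<?_)
open import Data.Nat.Properties using (≤-trans; +-suc; +-identityʳ; <⇒≱; ≮⇒≥)
open import Data.Product using (Σ; ∃; _×_; _,_; proj₁; proj₂)
open import Data.Sum using (inj₁; inj₂)
open import Data.Empty using (⊥-elim)
open import Relation.Nullary using (¬_; yes; no)
open import Relation.Binary.PropositionalEquality using (_≡_; refl; cong; subst; sym; trans)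
open import Axiom.ExcludedMiddle using (ExcludedMiddle)
open import Axiom.DoubleNegationElimination using (em⇒dne)

next : ℕ × ℕ → ℕ × ℕ
next (a , zero)  = (0 , suc a)
next (a , suc b) = (suc a , b)

decode : ℕ → ℕ × ℕ
decode zero    = (0 , 0)
decode (suc k) = next (decode k)

decode-walk : ∀ a b k → decode k ≡ (0 , a + b) → decode (k + a) ≡ (a , b)
decode-walk zero    b k eq rewrite +-identityʳ k = eq
decode-walk (suc a) b k eq rewrite +-suc k a =
  cong next (decode-walk a (suc b) k (trans eq (cong (0 ,_) (sym (+-suc a b)))))

decode-diagonal : ∀ s → ∃ λ k → decode k ≡ (0 , s)
decode-diagonal zero    = 0 , refl
decode-diagonal (suc s) =
  let k , eq = decode-diagonal s
  in suc (k + s) , cong next (decode-walk s 0 k (trans eq (cong (0 ,_) (sym (+-identityʳ s)))))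

decode-surjective : ∀ x → ∃ λ k → decode k ≡ x
decode-surjective (a , b) =
  let k , eq = decode-diagonal (a + b) in k + a , decode-walk a b k eq

code : ℕ × ℕ → ℕ
code x = proj₁ (decode-surjective x)

decode-code : ∀ x → decode (code x) ≡ x
decode-code x = proj₂ (decode-surjective x)

Above : Baire → Subset (ℕ × ℕ)
Above G (n , m) = G 0 ≤ n × G (suc n) ≤ m

Above-antitone : ∀ {G G′} → G ≤ᴮ G′ → Above G′ ⊆ˢ Above G
Above-antitone G≤G′ (n , m) (G′0≤n , G′n≤m) =
  ≤-trans (G≤G′ 0) G′0≤n , ≤-trans (G≤G′ (suc n)) G′n≤m

∁Above∈FinFin : ∀ G → FinFin (λ y → ¬ Above G y)
∁Above∈FinFin G = G 0 , bounded
  where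
  bounded : ∀ n → InfiniteSet (λ m → ¬ Above G (n , m)) → n < G 0
  bounded n infinite with n <? G 0
  ... | yes n<G0 = n<G0
  ... | no n≮G0  =
    let m , Gn≤m , notAbove = infinite (G (suc n))
    in ⊥-elim (notAbove (≮⇒≥ n≮G0 , Gn≤m))

∈-if-∁∈dualIdeal : ∀ {X} {U I : Family X} {A : Subset X} → IsUltrafilter U →
                   IdealInDual I U → I (λ x → ¬ A x) → U A
∈-if-∁∈dualIdeal {A = A} uf dual ∁A∈I with IsUltrafilter.ultra uf A
... | inj₁ A∈U  = A∈U
... | inj₂ ∁A∈U = ⊥-elim (dual _ ∁A∈I ∁A∈U)

module Classical (lem : ∀ {ℓ : Level} → ExcludedMiddle ℓ) where

  dne : ∀ {ℓ} {P : Set ℓ} → ¬ ¬ P → P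
  dne = em⇒dne lem

  bound-if-not-infinite : (P : ℕ → Set) → Σ ℕ λ k → ¬ InfiniteSet P → ∀ m → k ≤ m → ¬ P m
  bound-if-not-infinite P with lem {P = Σ ℕ λ k → ∀ m → k ≤ m → ¬ P m}
  ... | yes (k , bound) = k , λ _ → bound
  ... | no unbounded    = 0 , λ finite → ⊥-elim (finite λ k →
          dne λ none → unbounded (k , λ m k≤m Pm → none (m , k≤m , Pm)))

  FinFin⇒avoids-Above : ∀ {T} → FinFin T → Σ Baire λ G → ∀ y → Above G y → ¬ T y
  FinFin⇒avoids-Above {T} (N , finite) = G , avoids
    where
    G : Baire
    G zero    = N
    G (suc n) = proj₁ (bound-if-not-infinite (λ m → T (n , m)))

    avoids : ∀ y → Above G y → ¬ T y
    avoids (n , m) (N≤n , Gn≤m) =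
      proj₂ (bound-if-not-infinite (λ m → T (n , m)))
            (λ infinite → <⇒≱ (finite n infinite) N≤n) m Gn≤m

  pseudo-intersection-above : ∀ {U} → PseudoIntersection FinFin U →
    (S : ℕ → Subset (ℕ × ℕ)) → (∀ k → U (S k)) →
    Σ (Subset (ℕ × ℕ)) λ A → U A × Σ ProdBaire λ G → ∀ k y → A y → Above (G k) y → S k y
  pseudo-intersection-above pi S S∈U =
    let A , A∈U , small = pi S S∈U
    in A , A∈U , (λ k → proj₁ (FinFin⇒avoids-Above (small k))) ,
       λ k y Ay above → dne λ ¬Sy → proj₂ (FinFin⇒avoids-Above (small k)) y above (Ay , ¬Sy)

  Tukey⇒eventually-above : ∀ {a b} {P : Set a} {Q : Set b}
    {_≤P_ : P → P → Set} {_≤Q_ : Q → Q → Set} (t : TukeyLe P _≤P_ Q _≤Q_) →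
    ∀ p → Σ Q λ q → ∀ q′ → q ≤Q q′ → p ≤P proj₁ t q′
  -- Otherwise {q : p ≰ f q} is cofinal, yet its image under f misses p.
  Tukey⇒eventually-above {Q = Q} {_≤P_} {_≤Q_} (f , f-cofinal) p = dne λ never →
    let q , lift p≰fq , p≤fq = f-cofinal (λ q → Lift (lsuc lzero) (¬ p ≤P f q)) (escapes never) p
    in p≰fq p≤fq
    where
    escapes : ¬ (Σ Q λ q → ∀ q′ → q ≤Q q′ → p ≤P f q′) →
              Cofinal _≤Q_ (λ q → Lift (lsuc lzero) (¬ p ≤P f q))
    escapes never q = dne λ none →
      never (q , λ q′ q≤q′ → dne λ p≰fq′ → none (q′ , lift p≰fq′ , q≤q′))

  module _ {X : Set} {U : Family X} (uf : IsUltrafilter U) where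
    open IsUltrafilter uf

    largeSections : Elems (U ·ᶠ U) → Elems U
    largeSections (B , B∈) = (λ x → U (λ y → B (x , y))) , B∈

    ≤T-product : TukeyLe (Elems U) _⊇ᵁ_ (Elems (U ·ᶠ U)) _⊇ᵁ_
    ≤T-product = largeSections , cofinal
      where
      cofinal : ∀ C → Cofinal _⊇ᵁ_ C → ∀ A → Σ (Elems (U ·ᶠ U)) λ B → C B × A ⊇ᵁ largeSections B
      cofinal C C-cofinal (A , A∈) =
        let B , CB , B⊆A×X = C-cofinal ((λ (x , _) → A x) , A×X∈)
        in B , CB , λ x Bx∈U → dne λ ¬Ax →
             proper (upward _ _ (λ y Bxy → ¬Ax (B⊆A×X (x , y) Bxy)) Bx∈U)
        where
        A×X∈ : (U ·ᶠ U) (λ (x , _) → A x)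
        A×X∈ = upward _ _ (λ _ Ax → upward _ _ (λ _ _ → Ax) whole) A∈

    section-∈-if-large : ∀ (B : Subset (X × X)) x → U (λ y → U (λ y′ → B (x , y′)) → B (x , y))
    section-∈-if-large B x with lem {P = U (λ y → B (x , y))}
    ... | yes Bx∈U = upward _ _ (λ y Bxy _ → Bxy) Bx∈U
    ... | no  Bx∉U = upward _ _ (λ y _ Bx∈U → ⊥-elim (Bx∉U Bx∈U)) whole

  module _ {U : Family (ℕ × ℕ)} (uf : IsUltrafilter U) (dual : IdealInDual FinFin U)
           (pi : PseudoIntersection FinFin U)
           (tukey : TukeyLe ProdBaire _≤ᴾ_ (Elems U) (_⊇ᵁ_ {U = U})) where
    open IsUltrafilter uf

    h : Elems U → ProdBaire
    h = proj₁ tukey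

    Above-∈ : ∀ G → U (Above G)
    Above-∈ G = ∈-if-∁∈dualIdeal uf dual (∁Above∈FinFin G)

    squareAbove : Elems U → Elems (U ·ᶠ U)
    squareAbove (A , A∈) = (λ (x , y) → A x × A y × Above (h (A , A∈) (code x)) y) ,
      upward _ _ (λ x Ax → upward _ _ (λ y (Ay , above) → Ax , Ay , above)
                                      (inter _ _ A∈ (Above-∈ (h (A , A∈) (code x))))) A∈

    sections-controlled : ∀ (B : Subset ((ℕ × ℕ) × (ℕ × ℕ))) →
      Σ (Subset (ℕ × ℕ)) λ A → U A × Σ ProdBaire λ G →
        ∀ x y → A y → Above (G (code x)) y → U (λ y′ → B (x , y′)) → B (x , y)
    sections-controlled B =
      let A , A∈U , G , A-above = pseudo-intersection-above pi (λ k → Section (decode k))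
                                    (λ k → section-∈-if-large uf B (decode k))
      in A , A∈U , G , λ x y Ay above →
           subst (λ z → Section z y) (decode-code x) (A-above (code x) y Ay above)
      where
      Section : (ℕ × ℕ) → Subset (ℕ × ℕ)
      Section x y = U (λ y′ → B (x , y′)) → B (x , y)

    product-≤T : TukeyLe (Elems (U ·ᶠ U)) _⊇ᵁ_ (Elems U) _⊇ᵁ_
    product-≤T = squareAbove , cofinal
      where
      cofinal : ∀ C → Cofinal _⊇ᵁ_ C → ∀ B → Σ (Elems U) λ q → C q × B ⊇ᵁ squareAbove q
      cofinal C C-cofinal (B , B∈) =
        let A , A∈U , G , A-controls = sections-controlled B
            (Q , Q∈U) , Q-dominates = Tukey⇒eventually-above {_≤P_ = _≤ᴾ_} tukey G
            q , Cq , q⊆ = C-cofinal ((λ y → A y × Q y × U (λ y′ → B (y , y′))) ,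
                                     inter _ _ A∈U (inter _ _ Q∈U B∈))
            G≤hq = Q-dominates q (λ y qy → proj₁ (proj₂ (q⊆ y qy)))
        in q , Cq , λ (x , y) (qx , qy , above) →
             A-controls x y (proj₁ (q⊆ y qy)) (Above-antitone (G≤hq (code x)) y above)
                        (proj₂ (proj₂ (q⊆ x qx)))

corollary2p3 : (lem : ∀ {ℓ : Level} → ExcludedMiddle ℓ)
    → (U : Family (ℕ × ℕ))
    → IsUltrafilter U
    → IdealInDual FinFin U
    → PseudoIntersection FinFin U
    → TukeyLe ProdBaire _≤ᴾ_ (Elems U) (_⊇ᵁ_ {U = U})
    → TukeyEq (Elems (U ·ᶠ U)) (_⊇ᵁ_ {U = U ·ᶠ U}) (Elems U) (_⊇ᵁ_ {U = U})
corollary2p3 lem U uf dual pi tukey = product-≤T uf dual pi tukey , ≤T-product uf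
  where open Classical lem
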